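{- Let $\rho=\alpha(n-1)\beta n\in S_n$, where $\alpha$ and $\beta$ are nonempty sequences. Then $\mathrm{psb}^{ -1}(\mathrm{Av}(\rho))$ is not a permutation class.
   Context: A permutation contains a pattern $\rho\in S_k$ if some length-$k$ subsequence has entries in the same relative order as $\rho$; $\mathrm{Av}(\rho)$ is the set of all permutations avoiding $\rho$. A permutation class is a set of permutations closed under taking patterns. The algorithm PSB processes $\pi=\pi_1\cdots\pi_n$ from left to right with one pop stack $S$ (initially empty; PUSH puts an element on top, POP removes all elements appending them to the output from top to bottom) and an initially empty output: for $i=1,\dots,n$, if $S$ is empty or $\pi_i=\mathrm{TOP}(S)-1$ (where $\mathrm{TOP}(S)$ is the top element of $S$), push $\pi_i$; else if $\pi_i<\mathrm{TOP}(S)-1$, append $\pi_i$ directly to the output (bypass); otherwise pop $S$ and then push $\pi_i$. After all entries are processed, pop $S$. The output is $\mathrm{psb}(\pi)$, and $\mathrm{psb}^{ -1}(\mathcal{D})=\{\pi:\mathrm{psb}(\pi)\in\mathcal{D}\}$. -}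

module Defs where

open import Data.Nat using (ℕ; zero; suc; _<_; _≤_; _≤?_; _≟_)
open import Data.List using (List; []; _∷_; _++_; length; map; upTo; lookup)
open import Data.List.Relation.Binary.Permutation.Propositional using (_↭_)
open import Data.List.Relation.Binary.Sublist.Propositional using (_⊆_)
open import Data.Fin using (Fin; cast)
open import Data.Product using (Σ; ∃; _×_)
open import Function.Bundles using (_⇔_)
open import Relation.Nullary using (¬_; yes; no)
open import Relation.Binary.PropositionalEquality using (_≡_)

IsPerm : List ℕ → Set
IsPerm xs = xs ↭ map suc (upTo (length xs))

OrderIso : List ℕ → List ℕ → Set
OrderIso a b = Σ (length a ≡ length b) λ eq →
  (i j : Fin (length a)) →
    (lookup a i < lookup a j) ⇔ (lookup b (cast eq i) < lookup b (cast eq j))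

Contains : List ℕ → List ℕ → Set
Contains π ρ = ∃ λ σ → σ ⊆ π × OrderIso σ ρ

Avoids : List ℕ → List ℕ → Set
Avoids π ρ = ¬ Contains π ρ

Av : List ℕ → List ℕ → Set
Av ρ π = IsPerm π × Avoids π ρ

IsPermClass : (List ℕ → Set) → Set
IsPermClass C = (∀ π → C π → IsPerm π) ×
  (∀ π σ → C π → IsPerm σ → Contains π σ → C σ)

-- The algorithm PSB.  psbRun S input: the stack S is a list with its top first;
-- returns the output produced from now on.
psbRun : List ℕ → List ℕ → List ℕ
psbRun s [] = s                                   -- final POP (top to bottom)
psbRun [] (x ∷ xs) = psbRun (x ∷ []) xs
psbRun (t ∷ s) (x ∷ xs) with suc x ≟ t
... | yes _ = psbRun (x ∷ t ∷ s) xs               -- x = TOP(S) - 1: PUSH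
... | no _ with suc (suc x) ≤? t
...   | yes _ = x ∷ psbRun (t ∷ s) xs             -- x < TOP(S) - 1: bypass to output
...   | no _ = (t ∷ s) ++ psbRun (x ∷ []) xs      -- otherwise POP, then PUSH

psb : List ℕ → List ℕ
psb π = psbRun [] π

psbInv : (List ℕ → Set) → List ℕ → Set
psbInv D π = IsPerm π × D (psb π)

-- Write ρ = α k₁ β k₂ with kᵢ = k + i, so that α β is a permutation of 1 … k.  Take
--   σ = k₂ α k₃ β k₁   and   π = k₄ σ.
-- PSB sends π to k₂ α β k₁ k₃ k₄ (k₄ stays on the stack, k₃ is pushed on it, everything else
-- bypasses), and σ to α k₂ β k₁ k₃ (now k₂ is popped when k₃ arrives).  The latter contains
-- α k₂ β k₃, a copy of ρ.  The former avoids ρ: an occurrence uses all but two of its k + 4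
-- entries, and ρ has an entry above its first and its penultimate entry and below its last one,
-- which no such subsequence of k₂ α β k₁ k₃ k₄ has.  So π ∈ psb⁻¹(Av ρ) while its pattern σ is not.
module Submission where

open import Defs
open import Data.Nat using (ℕ; zero; suc; _+_; _∸_; _<_; _≤_; _≟_; _≤?_; z≤n; s≤s; s<s⁻¹)
open import Data.Nat.Properties
open import Data.List using (List; []; _∷_; _++_; length; map; upTo; lookup; initLast; _∷ʳ′_)
open import Data.List.Properties using (length-++; ++-assoc; ++-identityʳ; length-map; length-upTo; upTo-∷ʳ; map-++)
open import Data.List.Membership.Propositional using (_∈_)
open import Data.List.Membership.Propositional.Properties using (∈-++⁻; ∈-++⁺ʳ; ∈-map⁻; ∈-upTo⁻)
open import Data.List.Relation.Unary.Any using (here; there)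
open import Data.List.Relation.Unary.All as All using (All; []; _∷_)
open import Data.List.Relation.Unary.All.Properties as All using ()
open import Data.List.Relation.Binary.Pointwise as Pointwise using (Pointwise; []; _∷_)
open import Data.List.Relation.Binary.Sublist.Propositional using (_⊆_; []; _∷_; _∷ʳ_; ⊆-refl)
open import Data.List.Relation.Binary.Sublist.Propositional.Properties
  using (to-≋; All-resp-⊆) renaming (++⁺ to ⊆-++⁺; ++⁺ʳ to ⊆-++⁺ʳ)
open import Data.List.Relation.Binary.Equality.Propositional using (≋⇒≡)
open import Data.List.Relation.Binary.Permutation.Propositional
  using (_↭_; ↭-refl; ↭-sym; ↭-trans; ↭-prep; ↭-swap; ↭-reflexive; module PermutationReasoning)
open import Data.List.Relation.Binary.Permutation.Propositional.Properties
  using (shift; ∷↭∷ʳ; drop-∷; ∈-resp-↭; ↭-length; ++⁺ˡ)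
open import Data.Fin using (Fin; cast; toℕ; fromℕ<)
open import Data.Fin.Properties using (toℕ-cast; toℕ-fromℕ<)
open import Data.Product using (∃; _×_; _,_; proj₁)
open import Data.Sum using (_⊎_; inj₁; inj₂)
open import Data.Empty using (⊥; ⊥-elim)
open import Function using (_∘_; const)
open import Function.Bundles using (_⇔_; mk⇔; Equivalence)
import Function.Properties.Equivalence as ⇔
open import Relation.Nullary using (¬_; yes; no)
open import Relation.Binary.PropositionalEquality

-- Indexing from 0, with the junk value 0 past the end.
at : List ℕ → ℕ → ℕ
at []       _       = 0
at (x ∷ xs) zero    = x
at (x ∷ xs) (suc i) = at xs i

lookup≡at : (xs : List ℕ) (i : Fin (length xs)) → lookup xs i ≡ at xs (toℕ i)
lookup≡at (x ∷ xs) Fin.zero    = refl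
lookup≡at (x ∷ xs) (Fin.suc i) = lookup≡at xs i

at-++ʳ : (xs ys : List ℕ) (i : ℕ) → at (xs ++ ys) (i + length xs) ≡ at ys i
at-++ʳ []       ys i = cong (at ys) (+-identityʳ i)
at-++ʳ (x ∷ xs) ys i rewrite +-suc i (length xs) = at-++ʳ xs ys i

at-∈ : (xs : List ℕ) {i : ℕ} → i < length xs → at xs i ∈ xs
at-∈ (x ∷ xs) {zero}  _         = here refl
at-∈ (x ∷ xs) {suc i} (s≤s i<n) = there (at-∈ xs i<n)

OrderIso⇒at-< : ∀ {a b} → OrderIso a b → ∀ {i j} → i < length a → j < length a →
                at b i < at b j → at a i < at a j
OrderIso⇒at-< {a} {b} (eq , iso) {i} {j} i<n j<n bi<bj =
  subst₂ _<_ (at-a i<n) (at-a j<n)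
    (Equivalence.from (iso (fromℕ< i<n) (fromℕ< j<n)) (subst₂ _<_ (sym (at-b i<n)) (sym (at-b j<n)) bi<bj))
  where
  at-a : ∀ {m} (m<n : m < length a) → lookup a (fromℕ< m<n) ≡ at a m
  at-a m<n = trans (lookup≡at a _) (cong (at a) (toℕ-fromℕ< m<n))
  at-b : ∀ {m} (m<n : m < length a) → lookup b (cast eq (fromℕ< m<n)) ≡ at b m
  at-b m<n = trans (lookup≡at b _) (cong (at b) (trans (toℕ-cast eq _) (toℕ-fromℕ< m<n)))

Pointwise⇒OrderIso : ∀ {R : ℕ → ℕ → Set} → (∀ {x x′ y y′} → R x x′ → R y y′ → (x < y) ⇔ (x′ < y′)) →
                     ∀ {a b} → Pointwise R a b → OrderIso a b
Pointwise⇒OrderIso R-< p =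
  Pointwise.Pointwise-length p , λ i j → R-< (Pointwise.lookup⁺ p i) (Pointwise.lookup⁺ p j)

OrderIso-refl : (xs : List ℕ) → OrderIso xs xs
OrderIso-refl xs = Pointwise⇒OrderIso {_≡_} (λ { refl refl → ⇔.refl }) {xs} (Pointwise.refl refl)

data Raised (k : ℕ) : ℕ → ℕ → Set where
  kept   : ∀ {x} → x ≤ k → Raised k x x
  raised : ∀ {x} → k < x → Raised k (suc x) x

Raised-kept : ∀ {k xs} → All (_≤ k) xs → Pointwise (Raised k) xs xs
Raised-kept []           = []
Raised-kept (x≤k ∷ xs≤k) = kept x≤k ∷ Raised-kept xs≤k

Raised-<-⇔ : ∀ {k x x′ y y′} → Raised k x x′ → Raised k y y′ → (x < y) ⇔ (x′ < y′)
Raised-<-⇔ (kept _)      (kept _)      = ⇔.refl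
Raised-<-⇔ (kept x≤k)    (raised k<y)  =
  mk⇔ (const (≤-<-trans x≤k k<y)) (const (≤-<-trans x≤k (m<n⇒m<1+n k<y)))
Raised-<-⇔ {x′ = x′} {y} (raised k<x′) (kept y≤k) = mk⇔ (⊥-elim ∘ x′≮y ∘ <-trans (n<1+n x′)) (⊥-elim ∘ x′≮y)
  where
  x′≮y : ¬ x′ < y
  x′≮y = <-asym (≤-<-trans y≤k k<x′)
Raised-<-⇔ (raised _)    (raised _)    = mk⇔ s<s⁻¹ s≤s

-- When length τ ≡ suc (suc k), positions k and suc k are the last two entries of τ; in
-- ρ = α (n−1) β n the peak is the entry n − 1.
record Peaked (k : ℕ) (τ : List ℕ) : Set where
  field
    last<length      : suc k < length τ
    peak             : ℕ
    peak<length      : peak < length τ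
    first<peak       : at τ 0 < at τ peak
    penultimate<peak : at τ k < at τ peak
    peak<last        : at τ peak < at τ (suc k)

Peaked-resp-OrderIso : ∀ {k τ ρ} → OrderIso τ ρ → Peaked k ρ → Peaked k τ
Peaked-resp-OrderIso {k} {τ} {ρ} iso@(eq , _) P = record
  { last<length      = bound last<length
  ; peak             = peak
  ; peak<length      = bound peak<length
  ; first<peak       = transfer (≤-<-trans z≤n last<length) peak<length first<peak
  ; penultimate<peak = transfer (<-trans (n<1+n k) last<length) peak<length penultimate<peak
  ; peak<last        = transfer peak<length last<length peak<last
  }
  where
  open Peaked P
  bound : ∀ {i} → i < length ρ → i < length τ
  bound = subst (_ <_) (sym eq)
  transfer : ∀ {i j} → i < length ρ → j < length ρ → at ρ i < at ρ j → at τ i < at τ j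
  transfer i<n j<n = OrderIso⇒at-< {τ} {ρ} iso (bound i<n) (bound j<n)

first-dominates⇒¬Peaked : ∀ {k x y} (xs : List ℕ) → length xs ≡ k → All (_≤ x) xs →
                          ¬ Peaked k (x ∷ xs ++ y ∷ [])
first-dominates⇒¬Peaked {x = x} {y} xs refl xs≤x P = peak-cases (∈-++⁻ (x ∷ xs) (at-∈ τ peak<length))
  where
  open Peaked P
  τ : List ℕ
  τ = x ∷ xs ++ y ∷ []
  peak-cases : at τ peak ∈ x ∷ xs ⊎ at τ peak ∈ y ∷ [] → ⊥
  peak-cases (inj₁ peak∈)         = <⇒≱ first<peak (All.lookup (≤-refl ∷ xs≤x) peak∈)
  peak-cases (inj₂ (here peak≡y)) = <-irrefl (trans peak≡y (sym (at-++ʳ xs (y ∷ []) 0))) peak<last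

penultimate-dominates⇒¬Peaked : ∀ {k x y} (xs : List ℕ) → length xs ≡ k → All (_≤ x) xs →
                                ¬ Peaked k (xs ++ x ∷ y ∷ [])
penultimate-dominates⇒¬Peaked {x = x} {y} xs refl xs≤x P = peak-cases (∈-++⁻ xs (at-∈ τ peak<length))
  where
  open Peaked P
  τ : List ℕ
  τ = xs ++ x ∷ y ∷ []
  peak-cases : at τ peak ∈ xs ⊎ at τ peak ∈ x ∷ y ∷ [] → ⊥
  peak-cases (inj₁ peak∈) =
    <⇒≱ (subst (_< at τ peak) (at-++ʳ xs _ 0) penultimate<peak) (All.lookup xs≤x peak∈)
  peak-cases (inj₂ (here peak≡x))         = <-irrefl (trans (at-++ʳ xs _ 0) (sym peak≡x)) penultimate<peak
  peak-cases (inj₂ (there (here peak≡y))) = <-irrefl (trans peak≡y (sym (at-++ʳ xs _ 1))) peak<last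

split-⊆-++ : ∀ (xs ys : List ℕ) {τ} → τ ⊆ xs ++ ys →
             ∃ λ τ₁ → ∃ λ τ₂ → τ ≡ τ₁ ++ τ₂ × τ₁ ⊆ xs × τ₂ ⊆ ys
split-⊆-++ []       ys τ⊆ = [] , _ , refl , [] , τ⊆
split-⊆-++ (x ∷ xs) ys (.x ∷ʳ τ⊆) with split-⊆-++ xs ys τ⊆
... | τ₁ , τ₂ , refl , τ₁⊆ , τ₂⊆ = τ₁ , τ₂ , refl , x ∷ʳ τ₁⊆ , τ₂⊆
split-⊆-++ (x ∷ xs) ys (refl ∷ τ⊆) with split-⊆-++ xs ys τ⊆
... | τ₁ , τ₂ , refl , τ₁⊆ , τ₂⊆ = x ∷ τ₁ , τ₂ , refl , refl ∷ τ₁⊆ , τ₂⊆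

⊆-length⇒≡ : ∀ {xs ys : List ℕ} → xs ⊆ ys → length xs ≡ length ys → xs ≡ ys
⊆-length⇒≡ xs⊆ys len = ≋⇒≡ (to-≋ len xs⊆ys)

length-++-cancelʳ : (xs ys : List ℕ) {m : ℕ} → length (xs ++ ys) ≡ length ys + m → length xs ≡ m
length-++-cancelʳ xs ys eq =
  +-cancelˡ-≡ (length ys) _ _ (trans (+-comm (length ys) (length xs)) (trans (sym (length-++ xs)) eq))

psbRun-bypass : ∀ t s (xs ys : List ℕ) → All (λ x → suc x < t) xs →
                psbRun (t ∷ s) (xs ++ ys) ≡ xs ++ psbRun (t ∷ s) ys
psbRun-bypass t s []       ys []             = refl
psbRun-bypass t s (x ∷ xs) ys (1+x<t ∷ xs<t) with suc x ≟ t
... | yes 1+x≡t = ⊥-elim (<-irrefl 1+x≡t 1+x<t)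
... | no _ with suc (suc x) ≤? t
...   | yes _    = cong (x ∷_) (psbRun-bypass t s xs ys xs<t)
...   | no 1+x≮t = ⊥-elim (1+x≮t 1+x<t)

psbRun-bypass-all : ∀ t s (xs : List ℕ) → All (λ x → suc x < t) xs → psbRun (t ∷ s) xs ≡ xs ++ t ∷ s
psbRun-bypass-all t s xs xs<t =
  trans (cong (psbRun (t ∷ s)) (sym (++-identityʳ xs))) (psbRun-bypass t s xs [] xs<t)

psbRun-push : ∀ t s x (ys : List ℕ) → suc x ≡ t → psbRun (t ∷ s) (x ∷ ys) ≡ psbRun (x ∷ t ∷ s) ys
psbRun-push t s x ys 1+x≡t with suc x ≟ t
... | yes _    = refl
... | no 1+x≢t = ⊥-elim (1+x≢t 1+x≡t)

psbRun-pop : ∀ t s x (ys : List ℕ) → t ≤ x → psbRun (t ∷ s) (x ∷ ys) ≡ (t ∷ s) ++ psbRun (x ∷ []) ys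
psbRun-pop t s x ys t≤x with suc x ≟ t
... | yes 1+x≡t = ⊥-elim (<⇒≱ (s≤s t≤x) (≤-reflexive 1+x≡t))
... | no _ with suc (suc x) ≤? t
...   | yes 2+x≤t = ⊥-elim (<⇒≱ (≤-<-trans t≤x (n<1+n x)) (≤-trans (n≤1+n _) 2+x≤t))
...   | no _      = refl

psbRun-↭ : ∀ s (xs : List ℕ) → psbRun s xs ↭ s ++ xs
psbRun-↭ s        []       = ↭-sym (↭-reflexive (++-identityʳ s))
psbRun-↭ []       (x ∷ xs) = psbRun-↭ (x ∷ []) xs
psbRun-↭ (t ∷ s)  (x ∷ xs) with suc x ≟ t
... | yes _ = ↭-trans (psbRun-↭ (x ∷ t ∷ s) xs) (↭-sym (shift x (t ∷ s) xs))
... | no _ with suc (suc x) ≤? t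
...   | yes _ = ↭-trans (↭-prep x (psbRun-↭ (t ∷ s) xs)) (↭-sym (shift x (t ∷ s) xs))
...   | no _  = ++⁺ˡ (t ∷ s) (psbRun-↭ (x ∷ []) xs)

oneTo : ℕ → List ℕ
oneTo m = map suc (upTo m)

length-oneTo : ∀ m → length (oneTo m) ≡ m
length-oneTo m = trans (length-map suc (upTo m)) (length-upTo m)

oneTo-suc : ∀ m → oneTo (suc m) ↭ suc m ∷ oneTo m
oneTo-suc m = begin
  map suc (upTo (suc m))      ≡⟨ cong (map suc) (sym (upTo-∷ʳ m)) ⟩
  map suc (upTo m ++ m ∷ [])  ≡⟨ map-++ suc (upTo m) (m ∷ []) ⟩
  oneTo m ++ suc m ∷ []       ↭⟨ ↭-sym (∷↭∷ʳ (suc m) (oneTo m)) ⟩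
  suc m ∷ oneTo m             ∎
  where open PermutationReasoning

↭oneTo-cons : ∀ {xs m} → xs ↭ oneTo m → suc m ∷ xs ↭ oneTo (suc m)
↭oneTo-cons {m = m} xs↭ = ↭-trans (↭-prep (suc m) xs↭) (↭-sym (oneTo-suc m))

↭oneTo⇒IsPerm : ∀ {xs m} → xs ↭ oneTo m → IsPerm xs
↭oneTo⇒IsPerm {xs} xs↭ = subst (λ m → xs ↭ oneTo m) (sym (trans (↭-length xs↭) (length-oneTo _))) xs↭

↭oneTo⇒≤ : ∀ {xs m} → xs ↭ oneTo m → All (_≤ m) xs
↭oneTo⇒≤ xs↭ = All.tabulate (≤m ∘ ∈-map⁻ suc ∘ ∈-resp-↭ xs↭)
  where ≤m : ∀ {x m} → ∃ (λ y → y ∈ upTo m × x ≡ suc y) → x ≤ m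
        ≤m (_ , y∈ , refl) = ∈-upTo⁻ y∈

-- Whichever two entries are dropped, either the first entry of τ dominates all of τ but its last
-- entry, or the penultimate entry dominates everything before it.
¬Peaked-⊆ : ∀ {k x₁ x₂ x₃ x₄} (W : List ℕ) → length W ≡ k → All (_≤ x₁) W → x₁ ≤ x₂ → x₂ ≤ x₃ → ∀ {τ} →
            τ ⊆ (x₂ ∷ W ++ x₁ ∷ []) ++ x₃ ∷ x₄ ∷ [] → length τ ≡ suc (suc k) → ¬ Peaked k τ
¬Peaked-⊆ {k} {x₁} {x₂} {x₃} {x₄} W length-W W≤x₁ x₁≤x₂ x₂≤x₃ τ⊆ len
  with split-⊆-++ (x₂ ∷ W ++ x₁ ∷ []) _ τ⊆
... | τ₁ , τ₂ , refl , τ₁⊆ , τ₂⊆ = dropping τ₁⊆ τ₂⊆ len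
  where
  Q′ : List ℕ
  Q′ = W ++ x₁ ∷ []
  length-Q′ : length Q′ ≡ suc k
  length-Q′ = trans (length-++ W) (trans (+-comm (length W) 1) (cong suc length-W))
  W≤x₂ : All (_≤ x₂) W
  W≤x₂ = All.map (λ w≤x₁ → ≤-trans w≤x₁ x₁≤x₂) W≤x₁
  Q≤x₃ : All (_≤ x₃) (x₂ ∷ Q′)
  Q≤x₃ = All.map (λ q≤x₂ → ≤-trans q≤x₂ x₂≤x₃) (≤-refl ∷ All.++⁺ W≤x₂ (x₁≤x₂ ∷ []))
  one-kept : ∀ {τ₁ y} → τ₁ ⊆ x₂ ∷ Q′ → length τ₁ ≡ suc k → ¬ Peaked k (τ₁ ++ y ∷ [])
  one-kept (refl ∷ τ⊆) len =
    first-dominates⇒¬Peaked _ (suc-injective len) (All-resp-⊆ τ⊆ (All.++⁺ W≤x₂ (x₁≤x₂ ∷ [])))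
  one-kept {y = y} (_ ∷ʳ τ⊆) len with ⊆-length⇒≡ τ⊆ (trans len (sym length-Q′))
  ... | refl rewrite ++-assoc W (x₁ ∷ []) (y ∷ []) = penultimate-dominates⇒¬Peaked W length-W W≤x₁
  dropping : ∀ {τ₁ τ₂} → τ₁ ⊆ x₂ ∷ Q′ → τ₂ ⊆ x₃ ∷ x₄ ∷ [] → length (τ₁ ++ τ₂) ≡ suc (suc k) →
             ¬ Peaked k (τ₁ ++ τ₂)
  dropping {τ₁} τ₁⊆ (_ ∷ʳ (_ ∷ʳ [])) len rewrite ++-identityʳ τ₁
    with ⊆-length⇒≡ τ₁⊆ (trans len (cong suc (sym length-Q′)))
  ... | refl = first-dominates⇒¬Peaked W length-W W≤x₂
  dropping {τ₁} τ₁⊆ (refl ∷ (_ ∷ʳ [])) len = one-kept τ₁⊆ (length-++-cancelʳ τ₁ _ len)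
  dropping {τ₁} τ₁⊆ (_ ∷ʳ (refl ∷ [])) len = one-kept τ₁⊆ (length-++-cancelʳ τ₁ _ len)
  dropping {τ₁} τ₁⊆ (refl ∷ (refl ∷ [])) len =
    penultimate-dominates⇒¬Peaked τ₁ (length-++-cancelʳ τ₁ _ len) (All-resp-⊆ τ₁⊆ Q≤x₃)

++-∷ʳ↭∷ : ∀ x (xs ys : List ℕ) → xs ++ ys ++ x ∷ [] ↭ x ∷ xs ++ ys
++-∷ʳ↭∷ x xs ys = ↭-trans (↭-reflexive (sym (++-assoc xs ys (x ∷ [])))) (↭-sym (∷↭∷ʳ x (xs ++ ys)))

length-pattern : ∀ (α β : List ℕ) x y → length (α ++ x ∷ β ++ y ∷ []) ≡ suc (suc (length α + length β))
length-pattern α β x y = begin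
  length (α ++ x ∷ β ++ y ∷ [])          ≡⟨ length-++ α ⟩
  length α + suc (length (β ++ y ∷ []))  ≡⟨ cong (λ n → length α + suc n) (trans (length-++ β) (+-comm (length β) 1)) ⟩
  length α + suc (suc (length β))        ≡⟨ +-suc (length α) _ ⟩
  suc (length α + suc (length β))        ≡⟨ cong suc (+-suc (length α) _) ⟩
  suc (suc (length α + length β))        ∎
  where open ≡-Reasoning

Peaked-pattern : ∀ k (α β : List ℕ) → α ≢ [] → β ≢ [] → All (_≤ k) (α ++ β) →
                 length (α ++ suc k ∷ β ++ suc (suc k) ∷ []) ≡ suc (suc k) →
                 Peaked k (α ++ suc k ∷ β ++ suc (suc k) ∷ [])
Peaked-pattern k []      β α≢[] _ _ _ = ⊥-elim (α≢[] refl)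
Peaked-pattern k (a ∷ α) β _ β≢[] ≤k len with initLast β
... | []       = ⊥-elim (β≢[] refl)
... | β₀ ∷ʳ′ b = record
  { last<length      = subst (suc k <_) (sym len) (n<1+n (suc k))
  ; peak             = length (a ∷ α)
  ; peak<length      = subst (length (a ∷ α) <_) (sym (length-++ (a ∷ α))) (m<m+n _ (s≤s z≤n))
  ; first<peak       = subst (a <_) (sym at-peak) (s≤s (All.head ≤k))
  ; penultimate<peak = subst₂ _<_ (sym (at-from-end 0)) (sym at-peak) (s≤s b≤k)
  ; peak<last        = subst₂ _<_ (sym at-peak) (sym (at-from-end 1)) (n<1+n (suc k))
  }
  where
  ρ₀ end ρ : List ℕ
  ρ₀ = (a ∷ α) ++ suc k ∷ β₀
  end = b ∷ suc (suc k) ∷ []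
  ρ = (a ∷ α) ++ suc k ∷ (β₀ ++ b ∷ []) ++ suc (suc k) ∷ []
  ρ≡ : ρ ≡ ρ₀ ++ end
  ρ≡ = trans (cong (λ xs → (a ∷ α) ++ suc k ∷ xs) (++-assoc β₀ (b ∷ []) _)) (sym (++-assoc (a ∷ α) (suc k ∷ β₀) _))
  length-ρ₀ : length ρ₀ ≡ k
  length-ρ₀ = length-++-cancelʳ ρ₀ end (trans (cong length (sym ρ≡)) len)
  at-peak : at ρ (length (a ∷ α)) ≡ suc k
  at-peak = at-++ʳ (a ∷ α) _ 0
  at-from-end : ∀ i → at ρ (i + k) ≡ at end i
  at-from-end i = trans (cong (λ xs → at xs (i + k)) ρ≡)
                        (subst (λ m → at (ρ₀ ++ end) (i + m) ≡ at end i) length-ρ₀ (at-++ʳ ρ₀ end i))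
  b≤k : b ≤ k
  b≤k = All.lookup ≤k (∈-++⁺ʳ (a ∷ α) (∈-++⁺ʳ β₀ (here refl)))

IsPerm-pattern⇒↭oneTo : ∀ k (α β : List ℕ) → IsPerm (α ++ suc k ∷ β ++ suc (suc k) ∷ []) →
                        length (α ++ suc k ∷ β ++ suc (suc k) ∷ []) ≡ suc (suc k) → α ++ β ↭ oneTo k
IsPerm-pattern⇒↭oneTo k α β ρ-perm len = drop-∷ (drop-∷ (begin
  suc (suc k) ∷ suc k ∷ α ++ β         ↭⟨ ↭-swap _ _ ↭-refl ⟩
  suc k ∷ suc (suc k) ∷ α ++ β         ↭⟨ ↭-prep _ (↭-sym (++-∷ʳ↭∷ _ α β)) ⟩
  suc k ∷ α ++ β ++ suc (suc k) ∷ []   ↭⟨ ↭-sym (shift _ α _) ⟩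
  ρ                                    ↭⟨ subst (λ m → ρ ↭ oneTo m) len ρ-perm ⟩
  oneTo (suc (suc k))                  ↭⟨ oneTo-suc (suc k) ⟩
  suc (suc k) ∷ oneTo (suc k)          ↭⟨ ↭-prep _ (oneTo-suc k) ⟩
  suc (suc k) ∷ suc k ∷ oneTo k        ∎))
  where
  open PermutationReasoning
  ρ : List ℕ
  ρ = α ++ suc k ∷ β ++ suc (suc k) ∷ []

module Counterexample (k : ℕ) (A B : List ℕ) (AB↭ : A ++ B ↭ oneTo k) where

  k₁ k₂ k₃ k₄ : ℕ
  k₁ = suc k
  k₂ = suc k₁
  k₃ = suc k₂
  k₄ = suc k₃

  ρ σ π : List ℕ
  ρ = A ++ k₁ ∷ B ++ k₂ ∷ []
  σ = k₂ ∷ A ++ k₃ ∷ B ++ k₁ ∷ []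
  π = k₄ ∷ σ

  A≤k : All (_≤ k) A
  A≤k = All.++⁻ˡ A (↭oneTo⇒≤ AB↭)

  B≤k : All (_≤ k) B
  B≤k = All.++⁻ʳ A (↭oneTo⇒≤ AB↭)

  k₂≤k₃ : k₂ ≤ k₃
  k₂≤k₃ = n≤1+n k₂

  k₂≤k₄ : k₂ ≤ k₄
  k₂≤k₄ = m≤n⇒m≤1+n k₂≤k₃

  bypasses : ∀ {t x} → k₂ ≤ t → x ≤ k → suc x < t
  bypasses k₂≤t x≤k = ≤-trans (s≤s (s≤s x≤k)) k₂≤t

  σ-perm : σ ↭ oneTo k₃
  σ-perm = begin
    k₂ ∷ A ++ k₃ ∷ B ++ k₁ ∷ []   ↭⟨ ↭-prep k₂ (shift k₃ A _) ⟩
    k₂ ∷ k₃ ∷ A ++ B ++ k₁ ∷ []   ↭⟨ ↭-swap k₂ k₃ ↭-refl ⟩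
    k₃ ∷ k₂ ∷ A ++ B ++ k₁ ∷ []   ↭⟨ ↭-prep k₃ (↭-prep k₂ (++-∷ʳ↭∷ k₁ A B)) ⟩
    k₃ ∷ k₂ ∷ k₁ ∷ A ++ B         ↭⟨ ↭oneTo-cons (↭oneTo-cons (↭oneTo-cons AB↭)) ⟩
    oneTo k₃                      ∎
    where open PermutationReasoning

  psb-π : psb π ≡ (k₂ ∷ (A ++ B) ++ k₁ ∷ []) ++ k₃ ∷ k₄ ∷ []
  psb-π = begin
    psbRun (k₄ ∷ []) ((k₂ ∷ A) ++ k₃ ∷ B ++ k₁ ∷ [])
      ≡⟨ psbRun-bypass k₄ [] (k₂ ∷ A) _ (≤-refl ∷ All.map (bypasses k₂≤k₄) A≤k) ⟩
    k₂ ∷ A ++ psbRun (k₄ ∷ []) (k₃ ∷ B ++ k₁ ∷ [])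
      ≡⟨ cong (λ xs → k₂ ∷ A ++ xs) (psbRun-push k₄ [] k₃ _ refl) ⟩
    k₂ ∷ A ++ psbRun (k₃ ∷ k₄ ∷ []) (B ++ k₁ ∷ [])
      ≡⟨ cong (λ xs → k₂ ∷ A ++ xs) (psbRun-bypass-all k₃ _ _ (All.++⁺ (All.map (bypasses k₂≤k₃) B≤k) (≤-refl ∷ []))) ⟩
    k₂ ∷ A ++ (B ++ k₁ ∷ []) ++ k₃ ∷ k₄ ∷ []
      ≡⟨ cong (k₂ ∷_) (sym (++-assoc A _ _)) ⟩
    k₂ ∷ (A ++ B ++ k₁ ∷ []) ++ k₃ ∷ k₄ ∷ []
      ≡⟨ cong (λ xs → k₂ ∷ xs ++ k₃ ∷ k₄ ∷ []) (sym (++-assoc A B _)) ⟩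
    (k₂ ∷ (A ++ B) ++ k₁ ∷ []) ++ k₃ ∷ k₄ ∷ [] ∎
    where open ≡-Reasoning

  psb-σ : psb σ ≡ A ++ k₂ ∷ (B ++ k₁ ∷ []) ++ k₃ ∷ []
  psb-σ = begin
    psbRun (k₂ ∷ []) (A ++ k₃ ∷ B ++ k₁ ∷ [])
      ≡⟨ psbRun-bypass k₂ [] A _ (All.map (bypasses ≤-refl) A≤k) ⟩
    A ++ psbRun (k₂ ∷ []) (k₃ ∷ B ++ k₁ ∷ [])
      ≡⟨ cong (A ++_) (psbRun-pop k₂ [] k₃ _ k₂≤k₃) ⟩
    A ++ k₂ ∷ psbRun (k₃ ∷ []) (B ++ k₁ ∷ [])
      ≡⟨ cong (λ xs → A ++ k₂ ∷ xs) (psbRun-bypass-all k₃ _ _ (All.++⁺ (All.map (bypasses k₂≤k₃) B≤k) (≤-refl ∷ []))) ⟩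
    A ++ k₂ ∷ (B ++ k₁ ∷ []) ++ k₃ ∷ [] ∎
    where open ≡-Reasoning

  π-perm : π ↭ oneTo k₄
  π-perm = ↭oneTo-cons σ-perm

  psb-σ-contains-ρ : Contains (psb σ) ρ
  psb-σ-contains-ρ = ρ′ , subst (ρ′ ⊆_) (sym psb-σ) ⊆psb-σ , Pointwise⇒OrderIso Raised-<-⇔ ≅ρ
    where
    ρ′ : List ℕ
    ρ′ = A ++ k₂ ∷ B ++ k₃ ∷ []
    ⊆psb-σ : ρ′ ⊆ A ++ k₂ ∷ (B ++ k₁ ∷ []) ++ k₃ ∷ []
    ⊆psb-σ = ⊆-++⁺ ⊆-refl (refl ∷ ⊆-++⁺ {as = B} (⊆-++⁺ʳ (k₁ ∷ []) ⊆-refl) ⊆-refl)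
    ≅ρ : Pointwise (Raised k) ρ′ ρ
    ≅ρ = Pointwise.++⁺ (Raised-kept A≤k)
           (raised (n<1+n k) ∷ Pointwise.++⁺ (Raised-kept B≤k) (raised (m<n⇒m<1+n (n<1+n k)) ∷ []))

  psb-π-avoids-ρ : Peaked k ρ → Avoids (psb π) ρ
  psb-π-avoids-ρ ρ-peaked (τ , τ⊆ , τ≅ρ) =
    ¬Peaked-⊆ (A ++ B) length-AB (All.map m≤n⇒m≤1+n (↭oneTo⇒≤ AB↭)) (n≤1+n k₁) k₂≤k₃
      (subst (τ ⊆_) psb-π τ⊆) (trans (proj₁ τ≅ρ) length-ρ)
      (Peaked-resp-OrderIso {τ = τ} {ρ} τ≅ρ ρ-peaked)
    where
    length-AB : length (A ++ B) ≡ k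
    length-AB = trans (↭-length AB↭) (length-oneTo k)
    length-ρ : length ρ ≡ k₂
    length-ρ = trans (length-pattern A B k₁ k₂) (cong (suc ∘ suc) (trans (sym (length-++ A)) length-AB))

mainTheorem10 : (n : ℕ) (α β : List ℕ) → α ≢ [] → β ≢ [] →
    IsPerm (α ++ (n ∸ 1) ∷ β ++ n ∷ []) →
    length (α ++ (n ∸ 1) ∷ β ++ n ∷ []) ≡ n →
    ¬ IsPermClass (psbInv (Av (α ++ (n ∸ 1) ∷ β ++ n ∷ [])))
mainTheorem10 n α β α≢[] β≢[] ρ-perm ρ-length with trans (sym ρ-length) (length-pattern α β _ _)
... | refl = λ (_ , closed) →
  psb-σ-avoids-ρ (closed π σ π∈ (↭oneTo⇒IsPerm σ-perm) π-contains-σ) psb-σ-contains-ρ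
  where
  k : ℕ
  k = length α + length β
  αβ↭ : α ++ β ↭ oneTo k
  αβ↭ = IsPerm-pattern⇒↭oneTo k α β ρ-perm ρ-length
  open Counterexample k α β αβ↭
  π-contains-σ : Contains π σ
  π-contains-σ = σ , k₄ ∷ʳ ⊆-refl , OrderIso-refl σ
  π∈ : psbInv (Av ρ) π
  π∈ = ↭oneTo⇒IsPerm π-perm , ↭oneTo⇒IsPerm (↭-trans (psbRun-↭ [] π) π-perm)
     , psb-π-avoids-ρ (Peaked-pattern k α β α≢[] β≢[] (↭oneTo⇒≤ αβ↭) ρ-length)
  psb-σ-avoids-ρ : psbInv (Av ρ) σ → Avoids (psb σ) ρ
  psb-σ-avoids-ρ (_ , _ , avoids) = avoids
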